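{- Let $G$ be a connected unicyclic graph with $n$ vertices whose unique cycle has $c$ vertices ($3\le c\le n$). Then the number of $1$-Lipschitz mappings of $G$ is $$|\mathcal{L}_1(G)| = \binom{c}{0}_2\cdot 3^{\,n-c},$$ where $\binom{c}{0}_2$ is the $c$-th central trinomial coefficient.
   Context: A graph is unicyclic if it contains exactly one cycle. The trinomial coefficient $\binom{n}{k}_2$ is the coefficient of $x^k$ in $(x^{ -1}+1+x)^n$ (equivalently defined by $\binom{0}{0}_2=1$ and $\binom{n+1}{k}_2=\binom{n}{k-1}_2+\binom{n}{k}_2+\binom{n}{k+1}_2$); $\binom{c}{0}_2$ is the central trinomial coefficient. For a connected graph $G=(V,E)$ with a fixed root $v_0$, a $1$-Lipschitz mapping is a map $f:V\to\mathbb{Z}$ with $f(v_0)=0$ and $|f(u)-f(v)|\le 1$ for every edge $uv$; $\mathcal{L}_1(G)$ is the set of these. -}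

module Defs where

open import Level using (0ℓ)
open import Data.Nat as ℕ using (ℕ; zero; suc)
open import Data.Integer as ℤ using (ℤ; +_; ∣_∣)
open import Data.Fin using (Fin)
open import Data.Vec using (Vec; lookup)
open import Data.List using (List; []; _∷_; length)
open import Data.List.Membership.Propositional using (_∈_)
open import Data.List.Relation.Unary.Unique.Propositional using (Unique)
open import Data.Product using (Σ; ∃; _×_)
open import Data.Sum using (_⊎_)
open import Data.Unit using (⊤)
open import Data.Empty using (⊥)
open import Relation.Nullary using (¬_; yes; no)
open import Relation.Binary.PropositionalEquality using (_≡_)
open import Function.Bundles using (_⇔_)

record SimpleGraph (n : ℕ) : Set₁ where
  field
    Adj   : Fin n → Fin n → Set
    sym   : ∀ {u v} → Adj u v → Adj v u
    irrefl : ∀ {v} → ¬ Adj v v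
open SimpleGraph public

data Walk {n : ℕ} (G : SimpleGraph n) : Fin n → Fin n → Set where
  nil  : ∀ {v} → Walk G v v
  cons : ∀ {u w v} → Adj G u w → Walk G w v → Walk G u v

Connected : ∀ {n} → SimpleGraph n → Set
Connected G = ∀ u v → Walk G u v

Path : ∀ {n} → SimpleGraph n → List (Fin n) → Set
Path G []            = ⊤
Path G (x ∷ [])      = ⊤
Path G (x ∷ y ∷ xs)  = Adj G x y × Path G (y ∷ xs)

lastOf : ∀ {n} → Fin n → List (Fin n) → Fin n
lastOf x []       = x
lastOf x (y ∷ ys) = lastOf y ys

IsCycle : ∀ {n} → SimpleGraph n → List (Fin n) → Set
IsCycle G []       = ⊥
IsCycle G (x ∷ xs) =
  Unique (x ∷ xs) × (3 ℕ.≤ length (x ∷ xs)) × Path G (x ∷ xs) × Adj G (lastOf x xs) x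

ConsecPair : ∀ {n} → List (Fin n) → Fin n → Fin n → Set
ConsecPair []           u v = ⊥
ConsecPair (x ∷ [])     u v = ⊥
ConsecPair (x ∷ y ∷ xs) u v =
  ((u ≡ x × v ≡ y) ⊎ (u ≡ y × v ≡ x)) ⊎ ConsecPair (y ∷ xs) u v

CycleEdge : ∀ {n} → List (Fin n) → Fin n → Fin n → Set
CycleEdge []       u v = ⊥
CycleEdge (x ∷ xs) u v =
  ConsecPair (x ∷ xs) u v ⊎ ((u ≡ lastOf x xs × v ≡ x) ⊎ (u ≡ x × v ≡ lastOf x xs))

-- G contains exactly one cycle (as a subgraph, i.e. determined by its edge set),
-- and that cycle has c vertices.
UnicyclicWithCycleLength : ∀ {n} → SimpleGraph n → ℕ → Set
UnicyclicWithCycleLength {n} G c =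
  Σ (List (Fin n)) λ C → IsCycle G C × length C ≡ c ×
    (∀ C' → IsCycle G C' → ∀ u v → CycleEdge C' u v ⇔ CycleEdge C u v)

IsLipschitz1 : ∀ {n} → SimpleGraph n → Fin n → Vec ℤ n → Set
IsLipschitz1 G v₀ f =
  lookup f v₀ ≡ + 0 × (∀ u v → Adj G u v → ∣ lookup f u ℤ.- lookup f v ∣ ℕ.≤ 1)

NumLipschitz1≡ : ∀ {n} → SimpleGraph n → Fin n → ℕ → Set
NumLipschitz1≡ {n} G v₀ k =
  Σ (List (Vec ℤ n)) λ L → Unique L × length L ≡ k ×
    (∀ f → (f ∈ L) ⇔ IsLipschitz1 G v₀ f)

-- Trinomial coefficient (n choose k)_2: coefficient of x^k in (x⁻¹+1+x)^n.
trinomial : ℕ → ℤ → ℕ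
trinomial zero k with k ℤ.≟ + 0
... | yes _ = 1
... | no  _ = 0
trinomial (suc n) k =
  trinomial n (k ℤ.- + 1) ℕ.+ trinomial n k ℕ.+ trinomial n (k ℤ.+ + 1)

-- Let x, x₁, …, x_{c-1} be the cycle. Take a spanning tree rooted at x that contains the path
-- x x₁ … x_{c-1}; since the cycle is unique, every other edge of G would close a second cycle, so
-- every edge is a tree edge or the closing edge x_{c-1} x. A map f with f v₀ = 0 is therefore
-- determined by its increments f v - f (parent v) (v ≠ x), and it is 1-Lipschitz iff each increment
-- lies in {-1, 0, 1} and the c - 1 increments along the cycle sum to f x_{c-1} - f x ∈ {-1, 0, 1}.
-- The n - c off-cycle increments are free, giving 3^(n-c), and the cycle increments are counted by
-- T(c-1,-1) + T(c-1,0) + T(c-1,1) = T(c,0).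
module Submission where

open import Defs
open import Data.Nat using (ℕ; _≤_; _*_; _^_; _∸_)
open import Data.Integer using (+_)
open import Data.Fin using (Fin)
open import Data.Nat as ℕ using (zero; suc; z≤n; s≤s)
import Data.Nat.Properties as ℕP
open import Data.Integer as ℤ using (ℤ; -[1+_]; ∣_∣)
import Data.Integer.Properties as ℤP
import Data.Fin as F
import Data.Fin.Properties as FP
open import Data.Vec as V using (Vec; []; _∷_; lookup)
import Data.Vec.Properties as VP
open import Data.List as L using (List; []; _∷_; length; map; _++_; filter; cartesianProductWith)
open import Data.Nat.ListAction using (sum)
import Data.List.Properties as LP
open import Data.List.Membership.Propositional using (_∈_; _∉_)
open import Data.List.Membership.Propositional.Properties
open import Data.List.Relation.Unary.Any using (here; there)
import Data.List.Membership.DecPropositional as DecMembership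
open import Data.List.Relation.Unary.All as All using (All; []; _∷_)
open import Data.List.Relation.Unary.All.Properties using (¬Any⇒All¬) renaming (map⁺ to All-map⁺)
open import Data.List.Relation.Unary.Linked as Linked using (Linked; []; [-]; _∷_)
open import Data.List.Relation.Unary.Unique.Propositional using (Unique; []; _∷_)
import Data.List.Relation.Unary.Unique.Propositional.Properties as Unique
open import Data.Bool using (Bool; true; false; not; _∨_; _∧_; if_then_else_)
open import Data.Product using (Σ; _×_; _,_; proj₁; proj₂)
open import Data.Sum using (_⊎_; inj₁; inj₂)
open import Data.Empty using (⊥-elim)
open import Relation.Nullary using (yes; no; Dec; does)
open import Relation.Unary using (Pred; Decidable; _≐_)
open import Relation.Binary.PropositionalEquality as ≡ using (_≡_; _≢_; _≗_; refl; cong; cong₂; module ≡-Reasoning)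
open import Function using (_∘_; id; const)
open import Function.Bundles using (_⇔_; mk⇔; module Equivalence)
open import Data.Vec.Functional using (updateAt)
open import Data.Vec.Functional.Properties using (updateAt-updates; updateAt-minimal)
open import Level using (0ℓ)
open import Data.Integer.Tactic.RingSolver using (solve-∀)
import Data.Nat.Tactic.RingSolver as ℕSolver
open import Algebra.Bundles using (AbelianGroup)
open import Algebra.Properties.Group (AbelianGroup.group ℤP.+-0-abelianGroup) using (∙-cancelˡ)

module _ {A : Set} {P : Pred A 0ℓ} (P? : Decidable P) where

  length-filter-++ : ∀ xs ys →
    length (filter P? (xs ++ ys)) ≡ length (filter P? xs) ℕ.+ length (filter P? ys)
  length-filter-++ xs ys = ≡.trans (cong length (LP.filter-++ P? xs ys)) (LP.length-++ (filter P? xs))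

  length-filter-cartesianProductWith : ∀ {B C : Set} (f : B → C → A) xs ys →
    length (filter P? (cartesianProductWith f xs ys)) ≡ sum (map (λ x → length (filter P? (map (f x) ys))) xs)
  length-filter-cartesianProductWith f []       ys = refl
  length-filter-cartesianProductWith f (x ∷ xs) ys =
    ≡.trans (length-filter-++ (map (f x) ys) _) (cong (_ ℕ.+_) (length-filter-cartesianProductWith f xs ys))

Unique-map⁺-on : ∀ {A B : Set} {P : A → Set} (f : A → B) → (∀ {a b} → P a → P b → f a ≡ f b → a ≡ b) →
                 ∀ {xs} → All P xs → Unique xs → Unique (map f xs)
Unique-map⁺-on f inj []        []           = []
Unique-map⁺-on f inj (pa ∷ ps) (a≢xs ∷ u) =
  All-map⁺ (All.zipWith (λ (a≢b , pb) fa≡fb → a≢b (inj pa pb fa≡fb)) (a≢xs , ps)) ∷ Unique-map⁺-on f inj ps u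

length-filter-map : ∀ {A B : Set} {P : Pred B 0ℓ} (P? : Decidable P) (g : A → B) xs →
  length (filter P? (map g xs)) ≡ length (filter (P? ∘ g) xs)
length-filter-map P? g []       = refl
length-filter-map P? g (x ∷ xs) with does (P? (g x))
... | true  = cong suc (length-filter-map P? g xs)
... | false = length-filter-map P? g xs

∈-∉⇒≢ : ∀ {A : Set} {S : List A} {v w} → v ∈ S → w ∉ S → v ≢ w
∈-∉⇒≢ v∈S w∉S refl = w∉S v∈S

∉-∷⁺ : ∀ {A : Set} {S : List A} {y z} → y ≢ z → z ∉ S → z ∉ y ∷ S
∉-∷⁺ y≢z z∉S (here z≡y)  = y≢z (≡.sym z≡y)
∉-∷⁺ y≢z z∉S (there z∈S) = z∉S z∈S

lookup-ext : ∀ {A : Set} {n} {a b : Vec A n} → (∀ i → lookup a i ≡ lookup b i) → a ≡ b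
lookup-ext {a = a} {b} eq = ≡.trans (≡.sym (VP.tabulate∘lookup a)) (≡.trans (VP.tabulate-cong eq) (VP.tabulate∘lookup b))

-- Counting vectors in a box by a partial sum

box : ∀ {A : Set} {n} → (Fin n → List A) → List (Vec A n)
box {n = zero}  vs = [] ∷ []
box {n = suc n} vs = cartesianProductWith _∷_ (vs F.zero) (box (vs ∘ F.suc))

module _ {A : Set} where

  ∈-box⁺ : ∀ {n} (vs : Fin n → List A) (D : Vec A n) → (∀ i → lookup D i ∈ vs i) → D ∈ box vs
  ∈-box⁺ vs []      D∈ = here refl
  ∈-box⁺ vs (d ∷ D) D∈ = ∈-cartesianProductWith⁺ _∷_ (D∈ F.zero) (∈-box⁺ (vs ∘ F.suc) D (D∈ ∘ F.suc))

  ∈-box⁻ : ∀ {n} (vs : Fin n → List A) {D : Vec A n} → D ∈ box vs → ∀ i → lookup D i ∈ vs i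
  ∈-box⁻ {suc n} vs D∈ i with ∈-cartesianProductWith⁻ _∷_ (vs F.zero) (box (vs ∘ F.suc)) D∈
  ∈-box⁻ {suc n} vs D∈ F.zero    | d , D , d∈ , D∈′ , refl = d∈
  ∈-box⁻ {suc n} vs D∈ (F.suc i) | d , D , d∈ , D∈′ , refl = ∈-box⁻ (vs ∘ F.suc) D∈′ i

  box-unique : ∀ {n} (vs : Fin n → List A) → (∀ i → Unique (vs i)) → Unique (box vs)
  box-unique {zero}  vs _ = [] ∷ []
  box-unique {suc n} vs u =
    Unique.cartesianProductWith⁺ _∷_ VP.∷-injective (u F.zero) (box-unique (vs ∘ F.suc) (u ∘ F.suc))

count : ∀ {n} → (Fin n → Bool) → ℕ
count {zero}  p = 0
count {suc n} p = if p F.zero then suc (count (p ∘ F.suc)) else count (p ∘ F.suc)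

sumOver : ∀ {n} → (Fin n → Bool) → Vec ℤ n → ℤ
sumOver p []      = + 0
sumOver p (d ∷ D) = if p F.zero then d ℤ.+ sumOver (p ∘ F.suc) D else sumOver (p ∘ F.suc) D

_∈?_ : ∀ {n} (i : Fin n) (xs : List (Fin n)) → Dec (i ∈ xs)
_∈?_ {n} = DecMembership._∈?_ (FP._≟_ {n})

sumAt : ∀ {n} → Vec ℤ n → List (Fin n) → ℤ
sumAt D = L.foldr (λ i s → lookup D i ℤ.+ s) (+ 0)

count-cong : ∀ {n} {p q : Fin n → Bool} → p ≗ q → count p ≡ count q
count-cong {zero}  eq = refl
count-cong {suc n} eq = cong₂ (λ b r → if b then suc r else r) (eq F.zero) (count-cong (eq ∘ F.suc))

sumOver-cong : ∀ {n} {p q : Fin n → Bool} → p ≗ q → ∀ D → sumOver p D ≡ sumOver q D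
sumOver-cong eq []      = refl
sumOver-cong eq (d ∷ D) = cong₂ (λ b r → if b then d ℤ.+ r else r) (eq F.zero) (sumOver-cong (eq ∘ F.suc) D)

count-false : ∀ {n} → count {n} (λ _ → false) ≡ 0
count-false {zero}  = refl
count-false {suc n} = count-false {n}

sumOver-false : ∀ {n} (D : Vec ℤ n) → sumOver (λ _ → false) D ≡ + 0
sumOver-false []      = refl
sumOver-false (d ∷ D) = sumOver-false D

count-∨ : ∀ {n} (p q : Fin n → Bool) → (∀ i → p i ∧ q i ≡ false) →
          count (λ i → p i ∨ q i) ≡ count p ℕ.+ count q
count-∨ {zero}  p q disjoint = refl
count-∨ {suc n} p q disjoint
  with p F.zero | q F.zero | disjoint F.zero | count-∨ (p ∘ F.suc) (q ∘ F.suc) (disjoint ∘ F.suc)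
... | true  | false | _ | ih = cong suc ih
... | false | true  | _ | ih = ≡.trans (cong suc ih) (≡.sym (ℕP.+-suc _ _))
... | false | false | _ | ih = ih

sumOver-∨ : ∀ {n} (p q : Fin n → Bool) → (∀ i → p i ∧ q i ≡ false) → ∀ D →
            sumOver (λ i → p i ∨ q i) D ≡ sumOver p D ℤ.+ sumOver q D
sumOver-∨ p q disjoint [] = refl
sumOver-∨ p q disjoint (d ∷ D)
  with p F.zero | q F.zero | disjoint F.zero | sumOver-∨ (p ∘ F.suc) (q ∘ F.suc) (disjoint ∘ F.suc) D
... | true  | false | _ | ih = ≡.trans (cong (λ z → d ℤ.+ z) ih) (≡.sym (ℤP.+-assoc d _ _))
... | false | true  | _ | ih = ≡.trans (cong (λ z → d ℤ.+ z) ih) (exchange d (sumOver (p ∘ F.suc) D) (sumOver (q ∘ F.suc) D))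
  where
  exchange : ∀ a b c → a ℤ.+ (b ℤ.+ c) ≡ b ℤ.+ (a ℤ.+ c)
  exchange = solve-∀
... | false | false | _ | ih = ih

count-≟ : ∀ {n} (y : Fin n) → count (λ i → does (i FP.≟ y)) ≡ 1
count-≟ {suc n} F.zero    = cong suc (count-false {n})
count-≟ {suc n} (F.suc y) = count-≟ y

sumOver-≟ : ∀ {n} (y : Fin n) D → sumOver (λ i → does (i FP.≟ y)) D ≡ lookup D y
sumOver-≟ F.zero    (d ∷ D) = ≡.trans (cong (λ z → d ℤ.+ z) (sumOver-false D)) (ℤP.+-identityʳ d)
sumOver-≟ (F.suc y) (d ∷ D) = sumOver-≟ y D

≟-∧-∈?-disjoint : ∀ {n} {y : Fin n} {ys} → y ∉ ys → ∀ i → does (i FP.≟ y) ∧ does (i ∈? ys) ≡ false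
≟-∧-∈?-disjoint {y = y} {ys} y∉ys i with i FP.≟ y | i ∈? ys
... | yes refl | yes i∈ys = ⊥-elim (y∉ys i∈ys)
... | yes _    | no _     = refl
... | no _     | _        = refl

count-∈ : ∀ {n} {xs : List (Fin n)} → Unique xs → count (λ i → does (i ∈? xs)) ≡ length xs
count-∈ {n} []                    = count-false {n}
count-∈ {xs = y ∷ ys} (y∉ys ∷ u) =
  ≡.trans (count-∨ _ _ (≟-∧-∈?-disjoint (Unique.Unique[x∷xs]⇒x∉xs (y∉ys ∷ u))))
          (cong₂ ℕ._+_ (count-≟ y) (count-∈ u))

sumOver-∈ : ∀ {n} {xs : List (Fin n)} → Unique xs → ∀ D → sumOver (λ i → does (i ∈? xs)) D ≡ sumAt D xs
sumOver-∈ []                     D = sumOver-false D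
sumOver-∈ {xs = y ∷ ys} (y∉ys ∷ u) D =
  ≡.trans (sumOver-∨ _ _ (≟-∧-∈?-disjoint (Unique.Unique[x∷xs]⇒x∉xs (y∉ys ∷ u))) D)
          (cong₂ ℤ._+_ (sumOver-≟ y D) (sumOver-∈ u D))

count+count-not : ∀ {n} (p : Fin n → Bool) → count p ℕ.+ count (not ∘ p) ≡ n
count+count-not {zero}  p = refl
count+count-not {suc n} p with p F.zero | count+count-not (p ∘ F.suc)
... | true  | ih = cong suc ih
... | false | ih = ≡.trans (ℕP.+-suc _ _) (cong suc ih)

count≤ : ∀ {n} (p : Fin n → Bool) → count p ≤ n
count≤ p = ≡.subst (count p ≤_) (count+count-not p) (ℕP.m≤m+n _ _)

length≤ : ∀ {n} {xs : List (Fin n)} → Unique xs → length xs ≤ n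
length≤ u = ≡.subst (_≤ _) (count-∈ u) (count≤ _)

unit : List ℤ
unit = -[1+ 0 ] ∷ + 0 ∷ + 1 ∷ []

∣∣≤1⇒∈unit : ∀ z → ∣ z ∣ ≤ 1 → z ∈ unit
∣∣≤1⇒∈unit (+ 0)            _         = there (here refl)
∣∣≤1⇒∈unit (+ 1)            _         = there (there (here refl))
∣∣≤1⇒∈unit -[1+ 0 ]         _         = here refl
∣∣≤1⇒∈unit (+ suc (suc k))  (s≤s ())
∣∣≤1⇒∈unit -[1+ suc k ]     (s≤s ())

∈unit⇒∣∣≤1 : ∀ {z} → z ∈ unit → ∣ z ∣ ≤ 1
∈unit⇒∣∣≤1 (here refl)                 = ℕP.≤-refl
∈unit⇒∣∣≤1 (there (here refl))         = z≤n
∈unit⇒∣∣≤1 (there (there (here refl))) = ℕP.≤-refl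

data Role : Set where
  fixed summed free : Role

values : Role → List ℤ
values fixed  = + 0 ∷ []
values summed = unit
values free   = unit

values-unique : ∀ r → Unique (values r)
values-unique fixed  = [] ∷ []
values-unique summed = ((λ ()) ∷ (λ ()) ∷ []) ∷ ((λ ()) ∷ []) ∷ [] ∷ []
values-unique free   = ((λ ()) ∷ (λ ()) ∷ []) ∷ ((λ ()) ∷ []) ∷ [] ∷ []

isSummed isFree : Role → Bool
isSummed summed = true
isSummed _      = false
isFree free = true
isFree _    = false

hasSum? : ∀ {n} (ρ : Fin n → Role) k → Decidable (λ (D : Vec ℤ n) → sumOver (isSummed ∘ ρ) D ≡ k)
hasSum? ρ k D = sumOver (isSummed ∘ ρ) D ℤ.≟ k

withSum : ∀ {n} → (Fin n → Role) → ℤ → List (Vec ℤ n)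
withSum ρ k = filter (hasSum? ρ k) (box (values ∘ ρ))

+-shift-≐ : ∀ {A : Set} (s : A → ℤ) d k k′ → d ℤ.+ k′ ≡ k → (λ a → d ℤ.+ s a ≡ k) ≐ (λ a → s a ≡ k′)
+-shift-≐ s d k k′ d+k′≡k = (λ d+s≡k → ∙-cancelˡ d _ _ (≡.trans d+s≡k (≡.sym d+k′≡k)))
                          , (λ s≡k′ → ≡.trans (cong (λ z → d ℤ.+ z) s≡k′) d+k′≡k)

length-withSum-branch : ∀ {n} r (rs : Vec Role n) k d k′ → (if isSummed r then d ℤ.+ k′ else k′) ≡ k →
  length (filter (hasSum? (lookup (r ∷ rs)) k) (map (V._∷_ d) (box (values ∘ lookup rs))))
    ≡ length (withSum (lookup rs) k′)
length-withSum-branch summed rs k d k′ d+k′≡k =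
  ≡.trans (length-filter-map (hasSum? (lookup (summed ∷ rs)) k) (V._∷_ d) L)
          (cong length (LP.filter-≐ (hasSum? (lookup (summed ∷ rs)) k ∘ V._∷_ d) (hasSum? (lookup rs) k′)
                                    (+-shift-≐ (sumOver (isSummed ∘ lookup rs)) d k k′ d+k′≡k) L))
  where L = box (values ∘ lookup rs)
length-withSum-branch fixed rs k d .k refl = length-filter-map (hasSum? (lookup (fixed ∷ rs)) k) (V._∷_ d) (box (values ∘ lookup rs))
length-withSum-branch free  rs k d .k refl = length-filter-map (hasSum? (lookup (free ∷ rs)) k) (V._∷_ d) (box (values ∘ lookup rs))

-- Stated for lookup rs, so that matching on the head role makes box, sumOver and count compute.
length-withSum : ∀ {n} (rs : Vec Role n) k →
  length (withSum (lookup rs) k) ≡ trinomial (count (isSummed ∘ lookup rs)) k * 3 ^ count (isFree ∘ lookup rs)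
length-withSum [] k with + 0 ℤ.≟ k | k ℤ.≟ + 0
... | yes _   | yes _   = refl
... | no _    | no _    = refl
... | yes 0≡k | no k≢0  = ⊥-elim (k≢0 (≡.sym 0≡k))
... | no 0≢k  | yes k≡0 = ⊥-elim (0≢k (≡.sym k≡0))
length-withSum (r ∷ rs) k = begin
    length (withSum (lookup (r ∷ rs)) k)
  ≡⟨ length-filter-cartesianProductWith (hasSum? (lookup (r ∷ rs)) k) V._∷_ (values r) L ⟩
    sum (map (B r) (values r))
  ≡⟨ byRole r ⟩
    trinomial (count (isSummed ∘ lookup (r ∷ rs))) k * 3 ^ count (isFree ∘ lookup (r ∷ rs))
  ∎
  where
  open ≡-Reasoning
  L = box (values ∘ lookup rs)
  T = trinomial (count (isSummed ∘ lookup rs))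
  p = 3 ^ count (isFree ∘ lookup rs)
  N : ℤ → ℕ
  N k′ = length (withSum (lookup rs) k′)
  N≡ : ∀ k′ → N k′ ≡ T k′ * p
  N≡ = length-withSum rs
  B : Role → ℤ → ℕ
  B r d = length (filter (hasSum? (lookup (r ∷ rs)) k) (map (V._∷_ d) L))
  byRole : ∀ r → sum (map (B r) (values r))
                   ≡ trinomial (count (isSummed ∘ lookup (r ∷ rs))) k * 3 ^ count (isFree ∘ lookup (r ∷ rs))
  byRole fixed = begin
      B fixed (+ 0) ℕ.+ 0   ≡⟨ ℕP.+-identityʳ _ ⟩
      B fixed (+ 0)         ≡⟨ length-withSum-branch fixed rs k (+ 0) k refl ⟩
      N k                   ≡⟨ N≡ k ⟩
      T k * p               ∎
  byRole free = begin
      B free -[1+ 0 ] ℕ.+ (B free (+ 0) ℕ.+ (B free (+ 1) ℕ.+ 0))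
    ≡⟨ cong₂ ℕ._+_ (branch -[1+ 0 ]) (cong₂ ℕ._+_ (branch (+ 0)) (cong (ℕ._+ 0) (branch (+ 1)))) ⟩
      T k * p ℕ.+ (T k * p ℕ.+ (T k * p ℕ.+ 0))
    ≡⟨ thrice (T k) p ⟩
      T k * (3 * p)
    ∎
    where
    branch : ∀ d → B free d ≡ T k * p
    branch d = ≡.trans (length-withSum-branch free rs k d k refl) (N≡ k)
    thrice : ∀ a b → a * b ℕ.+ (a * b ℕ.+ (a * b ℕ.+ 0)) ≡ a * (3 * b)
    thrice = ℕSolver.solve-∀
  byRole summed = begin
      B summed -[1+ 0 ] ℕ.+ (B summed (+ 0) ℕ.+ (B summed (+ 1) ℕ.+ 0))
    ≡⟨ cong₂ ℕ._+_ (length-withSum-branch summed rs k -[1+ 0 ] (k ℤ.+ + 1) (minus k))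
                   (cong₂ ℕ._+_ (length-withSum-branch summed rs k (+ 0) k (ℤP.+-identityˡ k))
                                (cong (ℕ._+ 0) (length-withSum-branch summed rs k (+ 1) (k ℤ.- + 1) (plus k)))) ⟩
      N (k ℤ.+ + 1) ℕ.+ (N k ℕ.+ (N (k ℤ.- + 1) ℕ.+ 0))
    ≡⟨ cong₂ ℕ._+_ (N≡ _) (cong₂ ℕ._+_ (N≡ k) (cong (ℕ._+ 0) (N≡ _))) ⟩
      T (k ℤ.+ + 1) * p ℕ.+ (T k * p ℕ.+ (T (k ℤ.- + 1) * p ℕ.+ 0))
    ≡⟨ collect (T (k ℤ.+ + 1)) (T k) (T (k ℤ.- + 1)) p ⟩
      (T (k ℤ.- + 1) ℕ.+ T k ℕ.+ T (k ℤ.+ + 1)) * p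
    ∎
    where
    minus : ∀ k → -[1+ 0 ] ℤ.+ (k ℤ.+ + 1) ≡ k
    minus = solve-∀
    plus : ∀ k → + 1 ℤ.+ (k ℤ.- + 1) ≡ k
    plus = solve-∀
    collect : ∀ a b c p → a * p ℕ.+ (b * p ℕ.+ (c * p ℕ.+ 0)) ≡ (c ℕ.+ b ℕ.+ a) * p
    collect = ℕSolver.solve-∀

length-filter-∣∣≤1 : ∀ {A : Set} (s : A → ℤ) xs →
  length (filter (λ a → ∣ s a ∣ ℕ.≤? 1) xs)
    ≡ length (filter (λ a → s a ℤ.≟ -[1+ 0 ]) xs)
      ℕ.+ (length (filter (λ a → s a ℤ.≟ + 0) xs) ℕ.+ length (filter (λ a → s a ℤ.≟ + 1) xs))
length-filter-∣∣≤1 s []       = refl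
length-filter-∣∣≤1 s (a ∷ xs) with s a | length-filter-∣∣≤1 s xs
... | + 0            | ih = ≡.trans (cong suc ih) (≡.sym (ℕP.+-suc _ _))
... | + 1            | ih = ≡.trans (cong suc ih) (≡.trans (≡.sym (ℕP.+-suc c₋ _)) (cong (c₋ ℕ.+_) (≡.sym (ℕP.+-suc c₀ _))))
  where
  c₋ = length (filter (λ a → s a ℤ.≟ -[1+ 0 ]) xs)
  c₀ = length (filter (λ a → s a ℤ.≟ + 0) xs)
... | + suc (suc k)  | ih = ih
... | -[1+ 0 ]       | ih = cong suc ih
... | -[1+ suc k ]   | ih = ih

centralSum? : ∀ {n} (ρ : Fin n → Role) → Decidable (λ (D : Vec ℤ n) → ∣ sumOver (isSummed ∘ ρ) D ∣ ≤ 1)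
centralSum? ρ D = ∣ sumOver (isSummed ∘ ρ) D ∣ ℕ.≤? 1

withCentralSum : ∀ {n} → (Fin n → Role) → List (Vec ℤ n)
withCentralSum ρ = filter (centralSum? ρ) (box (values ∘ ρ))

∈-withCentralSum⁻ : ∀ {n} (ρ : Fin n → Role) {D} → D ∈ withCentralSum ρ →
                    D ∈ box (values ∘ ρ) × ∣ sumOver (isSummed ∘ ρ) D ∣ ≤ 1
∈-withCentralSum⁻ ρ = ∈-filter⁻ (centralSum? ρ) {xs = box (values ∘ ρ)}

length-withCentralSum : ∀ {n} (rs : Vec Role n) →
  length (withCentralSum (lookup rs)) ≡ trinomial (suc (count (isSummed ∘ lookup rs))) (+ 0) * 3 ^ count (isFree ∘ lookup rs)
length-withCentralSum rs = begin
    length (withCentralSum (lookup rs))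
  ≡⟨ length-filter-∣∣≤1 (sumOver (isSummed ∘ lookup rs)) (box (values ∘ lookup rs)) ⟩
    N -[1+ 0 ] ℕ.+ (N (+ 0) ℕ.+ N (+ 1))
  ≡⟨ cong₂ ℕ._+_ (length-withSum rs _) (cong₂ ℕ._+_ (length-withSum rs _) (length-withSum rs _)) ⟩
    T -[1+ 0 ] * p ℕ.+ (T (+ 0) * p ℕ.+ T (+ 1) * p)
  ≡⟨ collect (T -[1+ 0 ]) (T (+ 0)) (T (+ 1)) p ⟩
    (T -[1+ 0 ] ℕ.+ T (+ 0) ℕ.+ T (+ 1)) * p
  ∎
  where
  open ≡-Reasoning
  N = λ k → length (withSum (lookup rs) k)
  T = trinomial (count (isSummed ∘ lookup rs))
  p = 3 ^ count (isFree ∘ lookup rs)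
  collect : ∀ a b c p → a * p ℕ.+ (b * p ℕ.+ c * p) ≡ (a ℕ.+ b ℕ.+ c) * p
  collect = ℕSolver.solve-∀

module CycleRoles {n : ℕ} (x : Fin n) {xs : List (Fin n)} (x∉xs : x ∉ xs) (distinct : Unique xs) where

  role : Bool → Bool → Role
  role true  _     = summed
  role false true  = fixed
  role false false = free

  roles : Vec Role n
  roles = V.tabulate λ i → role (does (i ∈? xs)) (does (i FP.≟ x))

  ρ : Fin n → Role
  ρ = lookup roles

  isSummed∘ρ : ∀ i → isSummed (ρ i) ≡ does (i ∈? xs)
  isSummed∘ρ i = ≡.trans (cong isSummed (VP.lookup∘tabulate _ i)) (isSummed-role (does (i ∈? xs)) _)
    where
    isSummed-role : ∀ b c → isSummed (role b c) ≡ b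
    isSummed-role true  _     = refl
    isSummed-role false true  = refl
    isSummed-role false false = refl

  isFree∘ρ : ∀ i → isFree (ρ i) ≡ not (does (i ∈? (x ∷ xs)))
  isFree∘ρ i = ≡.trans (cong isFree (VP.lookup∘tabulate _ i)) (isFree-role (does (i ∈? xs)) _)
    where
    isFree-role : ∀ b c → isFree (role b c) ≡ not (c ∨ b)
    isFree-role true  true  = refl
    isFree-role true  false = refl
    isFree-role false true  = refl
    isFree-role false false = refl

  ρ-root : ρ x ≡ fixed
  ρ-root = ≡.trans (VP.lookup∘tabulate _ x) (at (x ∈? xs) (x FP.≟ x))
    where
    at : (a : Dec (x ∈ xs)) (b : Dec (x ≡ x)) → role (does a) (does b) ≡ fixed
    at (yes x∈xs) _         = ⊥-elim (x∉xs x∈xs)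
    at (no _)     (yes _)   = refl
    at (no _)     (no x≢x)  = ⊥-elim (x≢x refl)

  values∘ρ : ∀ {v} → v ≢ x → values (ρ v) ≡ unit
  values∘ρ {v} v≢x = ≡.trans (cong values (VP.lookup∘tabulate _ v)) (at (v ∈? xs) (v FP.≟ x))
    where
    at : (a : Dec (v ∈ xs)) (b : Dec (v ≡ x)) → values (role (does a) (does b)) ≡ unit
    at (yes _) _          = refl
    at (no _)  (yes v≡x)  = ⊥-elim (v≢x v≡x)
    at (no _)  (no _)     = refl

  cycleSum : ∀ D → sumOver (isSummed ∘ ρ) D ≡ sumAt D xs
  cycleSum D = ≡.trans (sumOver-cong isSummed∘ρ D) (sumOver-∈ distinct D)

  count-summed : count (isSummed ∘ ρ) ≡ length xs
  count-summed = ≡.trans (count-cong isSummed∘ρ) (count-∈ distinct)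

  count-free : count (isFree ∘ ρ) ≡ n ∸ suc (length xs)
  count-free = begin
      count (isFree ∘ ρ)
    ≡⟨ count-cong isFree∘ρ ⟩
      count (not ∘ onCycle)
    ≡⟨ ℕP.m+n∸m≡n (count onCycle) _ ⟨
      count onCycle ℕ.+ count (not ∘ onCycle) ∸ count onCycle
    ≡⟨ cong₂ _∸_ (count+count-not onCycle) (count-∈ (¬Any⇒All¬ xs x∉xs ∷ distinct)) ⟩
      n ∸ suc (length xs)
    ∎
    where
    open ≡-Reasoning
    onCycle = λ i → does (i ∈? (x ∷ xs))

-- Paths and spanning trees

Path⇒Linked : ∀ {n} {G : SimpleGraph n} l → Path G l → Linked (Adj G) l
Path⇒Linked []          _         = []
Path⇒Linked (a ∷ [])    _         = [-]
Path⇒Linked (a ∷ b ∷ l) (ab , p)  = ab ∷ Path⇒Linked (b ∷ l) p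

Linked⇒Path : ∀ {n} {G : SimpleGraph n} {l} → Linked (Adj G) l → Path G l
Linked⇒Path []       = _
Linked⇒Path [-]      = _
Linked⇒Path (ab ∷ p) = ab , Linked⇒Path p

lastOf-++ : ∀ {n} (a : Fin n) l m → lastOf a (l ++ m) ≡ lastOf (lastOf a l) m
lastOf-++ a []      m = refl
lastOf-++ a (b ∷ l) m = lastOf-++ b l m

module _ {n : ℕ} {R : Fin n → Fin n → Set} where

  Linked-++ : ∀ {a} l {m} → Linked R (a ∷ l) → Linked R (lastOf a l ∷ m) → Linked R (a ∷ l ++ m)
  Linked-++ []      p        q = q
  Linked-++ (b ∷ l) (ab ∷ p) q = ab ∷ Linked-++ l p q

  suffixFrom : ∀ {a h} t → a ∈ h ∷ t → Unique (h ∷ t) → Linked R (h ∷ t) →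
               Σ (List (Fin n)) λ s → Unique (a ∷ s) × Linked R (a ∷ s) × lastOf a s ≡ lastOf h t
  suffixFrom t       (here refl) u       p        = t , u , p , refl
  suffixFrom (h′ ∷ t) (there a∈t) (_ ∷ u) (_ ∷ p) = suffixFrom t a∈t u p

  shortcut : ∀ a l → Linked R (a ∷ l) →
             Σ (List (Fin n)) λ r → Unique (a ∷ r) × Linked R (a ∷ r) × lastOf a r ≡ lastOf a l
  shortcut a []      _        = [] , [] ∷ [] , [-] , refl
  shortcut a (b ∷ l) (ab ∷ p) with shortcut b l p
  ... | r , u , q , last with a ∈? (b ∷ r)
  ...   | yes a∈br = let s , us , qs , lasts = suffixFrom r a∈br u q in s , us , qs , ≡.trans lasts last
  ...   | no  a∉br = b ∷ r , ¬Any⇒All¬ (b ∷ r) a∉br ∷ u , ab ∷ q , last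

IsParentOf : ∀ {n} → (Fin n → Fin n) → Fin n → Fin n → Set
IsParentOf parent a b = parent b ≡ a

exitEdge : ∀ {n} {G : SimpleGraph n} {S : List (Fin n)} {v u} → v ∉ S → Walk G v u → u ∈ S →
           Σ (Fin n) λ w → Σ (Fin n) λ b → w ∉ S × b ∈ S × Adj G w b
exitEdge v∉S nil u∈S = ⊥-elim (v∉S u∈S)
exitEdge {S = S} {v} v∉S (cons {w = w} vw W) u∈S with w ∈? S
... | yes w∈S = v , w , v∉S , w∈S , vw
... | no  w∉S = exitEdge w∉S W u∈S

record RootedSpanningTree {n} (G : SimpleGraph n) (root : Fin n) : Set where
  field
    parent     : Fin n → Fin n
    depth      : Fin n → ℕ
    depth-root : depth root ≡ 0
    toParent   : ∀ v → v ≢ root → Adj G v (parent v) × suc (depth (parent v)) ≡ depth v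

module SpanningTree {n : ℕ} (G : SimpleGraph n) (root : Fin n) where

  record PartialTree (S : List (Fin n)) : Set where
    field
      parent     : Fin n → Fin n
      depth      : Fin n → ℕ
      distinct   : Unique S
      root∈      : root ∈ S
      depth-root : depth root ≡ 0
      toParent   : ∀ {v} → v ∈ S → v ≢ root →
                   parent v ∈ S × Adj G v (parent v) × suc (depth (parent v)) ≡ depth v
  open PartialTree

  record _⊑_ {S S′} (T : PartialTree S) (T′ : PartialTree S′) : Set where
    constructor extension
    field
      keeps       : ∀ {v} → v ∈ S → v ∈ S′
      keepsParent : ∀ {v} → v ∈ S → parent T′ v ≡ parent T v
  open _⊑_

  ⊑-refl : ∀ {S} {T : PartialTree S} → T ⊑ T
  ⊑-refl = extension id λ _ → refl

  ⊑-trans : ∀ {S₁ S₂ S₃} {T₁ : PartialTree S₁} {T₂ : PartialTree S₂} {T₃ : PartialTree S₃} →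
            T₁ ⊑ T₂ → T₂ ⊑ T₃ → T₁ ⊑ T₃
  ⊑-trans T₁⊑T₂ T₂⊑T₃ = extension (keeps T₂⊑T₃ ∘ keeps T₁⊑T₂)
    λ v∈ → ≡.trans (keepsParent T₂⊑T₃ (keeps T₁⊑T₂ v∈)) (keepsParent T₁⊑T₂ v∈)

  ⊑-Linked : ∀ {S S′} {T : PartialTree S} {T′ : PartialTree S′} → T ⊑ T′ → ∀ {a l} → All (_∈ S) l →
             Linked (IsParentOf (parent T)) (a ∷ l) → Linked (IsParentOf (parent T′)) (a ∷ l)
  ⊑-Linked T⊑T′ []           [-]      = [-]
  ⊑-Linked T⊑T′ (b∈S ∷ l∈S) (ab ∷ p) = ≡.trans (keepsParent T⊑T′ b∈S) ab ∷ ⊑-Linked T⊑T′ l∈S p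

  singleton : PartialTree (root ∷ [])
  singleton = record
    { parent     = id
    ; depth      = const 0
    ; distinct   = [] ∷ []
    ; root∈      = here refl
    ; depth-root = refl
    ; toParent   = λ { (here refl) v≢root → ⊥-elim (v≢root refl) }
    }

  extend : ∀ {S} (T : PartialTree S) {w b} → w ∉ S → b ∈ S → Adj G w b →
           Σ (PartialTree (w ∷ S)) λ T′ → T ⊑ T′ × parent T′ w ≡ b
  extend {S} T {w} {b} w∉S b∈S wb = T′ , extension there parent-old , updateAt-updates w (parent T)
    where
    parent′ = updateAt (parent T) w (const b)
    depth′  = updateAt (depth T) w (const (suc (depth T b)))
    parent-old : ∀ {v} → v ∈ S → parent′ v ≡ parent T v
    parent-old v∈S = updateAt-minimal _ w (parent T) (∈-∉⇒≢ v∈S w∉S)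
    depth-old : ∀ {v} → v ∈ S → depth′ v ≡ depth T v
    depth-old v∈S = updateAt-minimal _ w (depth T) (∈-∉⇒≢ v∈S w∉S)
    toParent′ : ∀ {v} → v ∈ w ∷ S → v ≢ root →
                parent′ v ∈ w ∷ S × Adj G v (parent′ v) × suc (depth′ (parent′ v)) ≡ depth′ v
    toParent′ (here refl) _ rewrite updateAt-updates w {const b} (parent T) =
      there b∈S , wb , ≡.trans (cong suc (depth-old b∈S)) (≡.sym (updateAt-updates w (depth T)))
    toParent′ {v} (there v∈S) v≢root rewrite parent-old v∈S =
      let p∈S , vp , deeper = toParent T v∈S v≢root
      in there p∈S , vp , ≡.trans (cong suc (depth-old p∈S)) (≡.trans deeper (≡.sym (depth-old v∈S)))
    T′ : PartialTree (w ∷ S)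
    T′ = record
      { parent     = parent′
      ; depth      = depth′
      ; distinct   = ¬Any⇒All¬ S w∉S ∷ distinct T
      ; root∈      = there (root∈ T)
      ; depth-root = ≡.trans (depth-old (root∈ T)) (depth-root T)
      ; toParent   = toParent′
      }

  attach : ∀ {S} (T : PartialTree S) {a} ys → a ∈ S → Unique ys → All (_∉ S) ys → Linked (Adj G) (a ∷ ys) →
           Σ (List (Fin n)) λ S′ → Σ (PartialTree S′) λ T′ →
             T ⊑ T′ × All (_∈ S′) ys × Linked (IsParentOf (parent T′)) (a ∷ ys)
  attach T []       a∈S _            _             _        = _ , T , ⊑-refl , [] , [-]
  attach T (y ∷ ys) a∈S (y≢ys ∷ u) (y∉S ∷ ys∉S) (ay ∷ p) with extend T y∉S a∈S (sym G ay)
  ... | T₁ , T⊑T₁ , py≡a with attach T₁ ys (here refl) u (All.zipWith (λ (y≢z , z∉S) → ∉-∷⁺ y≢z z∉S) (y≢ys , ys∉S)) p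
  ...   | S₂ , T₂ , T₁⊑T₂ , ys∈S₂ , chain =
    S₂ , T₂ , ⊑-trans T⊑T₁ T₁⊑T₂ , keeps T₁⊑T₂ (here refl) ∷ ys∈S₂ ,
    ≡.trans (keepsParent T₁⊑T₂ (here refl)) py≡a ∷ chain

  -- The fuel k never runs out: a duplicate-free S has at most n elements.
  span : Connected G → ∀ k {S} (T : PartialTree S) → n ≤ k ℕ.+ length S →
         Σ (List (Fin n)) λ S′ → Σ (PartialTree S′) λ T′ → T ⊑ T′ × (∀ v → v ∈ S′)
  span conn k {S} T n≤k+∣S∣ with FP.all? (_∈? S)
  ... | yes all∈S = S , T , ⊑-refl , all∈S
  ... | no ¬all∈S with FP.¬∀⟶∃¬ n (_∈ S) (_∈? S) ¬all∈S | k
  ...   | v , v∉S | zero  = ⊥-elim (ℕP.<-irrefl refl (ℕP.<-≤-trans (length≤ (¬Any⇒All¬ S v∉S ∷ distinct T)) n≤k+∣S∣))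
  ...   | v , v∉S | suc k with exitEdge v∉S (conn v root) (root∈ T)
  ...     | w , b , w∉S , b∈S , wb with extend T w∉S b∈S wb
  ...       | T₁ , T⊑T₁ , _ with span conn k T₁ (≡.subst (n ≤_) (≡.sym (ℕP.+-suc k (length S))) n≤k+∣S∣)
  ...         | S₂ , T₂ , T₁⊑T₂ , all∈S₂ = S₂ , T₂ , ⊑-trans T⊑T₁ T₁⊑T₂ , all∈S₂

  spanningTreeThrough : Connected G → ∀ {xs} → Unique (root ∷ xs) → Linked (Adj G) (root ∷ xs) →
                        Σ (RootedSpanningTree G root) λ T → Linked (IsParentOf (RootedSpanningTree.parent T)) (root ∷ xs)
  spanningTreeThrough conn {xs} (root≢xs ∷ u) p
    with attach singleton xs (here refl) u (All.map (λ root≢x → ∉-∷⁺ root≢x λ ()) root≢xs) p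
  ... | S₁ , T₁ , _ , xs∈S₁ , chain₁ with span conn n T₁ (ℕP.m≤m+n n _)
  ...   | S₂ , T₂ , T₁⊑T₂ , all∈S₂ = tree , ⊑-Linked T₁⊑T₂ xs∈S₁ chain₁
    where
    tree : RootedSpanningTree G root
    tree = record
      { parent     = parent T₂
      ; depth      = depth T₂
      ; depth-root = depth-root T₂
      ; toParent   = λ v v≢root → let _ , vp , deeper = toParent T₂ (all∈S₂ v) v≢root in vp , deeper
      }

-- Coordinates of a map relative to a rooted spanning tree

i+j-i≡j : ∀ i j → (i ℤ.+ j) ℤ.- i ≡ j
i+j-i≡j = solve-∀

[i-k]-[j-k]≡i-j : ∀ i j k → (i ℤ.- k) ℤ.- (j ℤ.- k) ≡ i ℤ.- j
[i-k]-[j-k]≡i-j = solve-∀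

module TreeCoordinates {n : ℕ} {G : SimpleGraph n} {x : Fin n} (T : RootedSpanningTree G x) where

  open RootedSpanningTree T

  parent-depth : ∀ {v k} → v ≢ x → depth v ≡ suc k → depth (parent v) ≡ k
  parent-depth v≢x depth≡1+k = ℕP.suc-injective (≡.trans (proj₂ (toParent _ v≢x)) depth≡1+k)

  treeInduction : (P : Fin n → Set) → P x → (∀ {v} → v ≢ x → P (parent v) → P v) → ∀ v → P v
  treeInduction P base step v = go (depth v) v refl
    where
    go : ∀ k v → depth v ≡ k → P v
    go k v depth≡k with v FP.≟ x
    ... | yes refl = base
    go zero    v depth≡0 | no v≢x with () ← ≡.trans (proj₂ (toParent v v≢x)) depth≡0
    go (suc k) v depth≡k | no v≢x = step v≢x (go k (parent v) (parent-depth v≢x depth≡k))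

  potentialWithin : ℕ → Vec ℤ n → Fin n → ℤ
  potentialWithin zero    D v = + 0
  potentialWithin (suc k) D v = potentialWithin k D (parent v) ℤ.+ lookup D v

  potential : Vec ℤ n → Fin n → ℤ
  potential D v = potentialWithin (depth v) D v

  potential-root : ∀ D → potential D x ≡ + 0
  potential-root D = ≡.subst (λ k → potentialWithin k D x ≡ + 0) (≡.sym depth-root) refl

  potential-parent : ∀ D {v} → v ≢ x → potential D v ≡ potential D (parent v) ℤ.+ lookup D v
  potential-parent D {v} v≢x =
    ≡.subst (λ k → potentialWithin k D v ≡ potential D (parent v) ℤ.+ lookup D v) (proj₂ (toParent v v≢x)) refl

  potential-chain : ∀ D {a ys} → Linked (IsParentOf parent) (a ∷ ys) → All (x ≢_) ys →
                    potential D (lastOf a ys) ≡ potential D a ℤ.+ sumAt D ys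
  potential-chain D [-]                    []          = ≡.sym (ℤP.+-identityʳ _)
  potential-chain D {a} {b ∷ ys} (pb≡a ∷ p) (x≢b ∷ ≢x) = begin
      potential D (lastOf b ys)
    ≡⟨ potential-chain D p ≢x ⟩
      potential D b ℤ.+ sumAt D ys
    ≡⟨ cong (ℤ._+ sumAt D ys) (potential-parent D (≡.≢-sym x≢b)) ⟩
      potential D (parent b) ℤ.+ lookup D b ℤ.+ sumAt D ys
    ≡⟨ cong (λ z → potential D z ℤ.+ lookup D b ℤ.+ sumAt D ys) pb≡a ⟩
      potential D a ℤ.+ lookup D b ℤ.+ sumAt D ys
    ≡⟨ ℤP.+-assoc (potential D a) _ _ ⟩
      potential D a ℤ.+ sumAt D (b ∷ ys)
    ∎
    where open ≡-Reasoning

  increment : Vec ℤ n → Fin n → ℤ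
  increment f v with v FP.≟ x
  ... | yes _ = + 0
  ... | no  _ = lookup f v ℤ.- lookup f (parent v)

  increment-root : ∀ f → increment f x ≡ + 0
  increment-root f with x FP.≟ x
  ... | yes _   = refl
  ... | no x≢x = ⊥-elim (x≢x refl)

  increment-nonroot : ∀ f {v} → v ≢ x → increment f v ≡ lookup f v ℤ.- lookup f (parent v)
  increment-nonroot f {v} v≢x with v FP.≟ x
  ... | yes v≡x = ⊥-elim (v≢x v≡x)
  ... | no  _   = refl

  increments : Vec ℤ n → Vec ℤ n
  increments f = V.tabulate (increment f)

  potential-increments : ∀ f v → potential (increments f) v ≡ lookup f v ℤ.- lookup f x
  potential-increments f = treeInduction (λ v → potential (increments f) v ≡ lookup f v ℤ.- lookup f x)
    (≡.trans (potential-root _) (≡.sym (ℤP.+-inverseʳ (lookup f x))))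
    λ {v} v≢x ih → begin
      potential (increments f) v
    ≡⟨ potential-parent _ v≢x ⟩
      potential (increments f) (parent v) ℤ.+ lookup (increments f) v
    ≡⟨ cong₂ ℤ._+_ ih (VP.lookup∘tabulate _ v) ⟩
      (lookup f (parent v) ℤ.- lookup f x) ℤ.+ increment f v
    ≡⟨ cong (λ z → (lookup f (parent v) ℤ.- lookup f x) ℤ.+ z) (increment-nonroot f v≢x) ⟩
      (lookup f (parent v) ℤ.- lookup f x) ℤ.+ (lookup f v ℤ.- lookup f (parent v))
    ≡⟨ telescope (lookup f v) (lookup f (parent v)) (lookup f x) ⟩
      lookup f v ℤ.- lookup f x
    ∎
    where
    open ≡-Reasoning
    telescope : ∀ a b c → (b ℤ.- c) ℤ.+ (a ℤ.- b) ≡ a ℤ.- c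
    telescope = solve-∀

  integrate : Fin n → Vec ℤ n → Vec ℤ n
  integrate v₀ D = V.tabulate (λ v → potential D v ℤ.- potential D v₀)

  integrate-base : ∀ v₀ D → lookup (integrate v₀ D) v₀ ≡ + 0
  integrate-base v₀ D = ≡.trans (VP.lookup∘tabulate _ v₀) (ℤP.+-inverseʳ (potential D v₀))

  integrate-difference : ∀ v₀ D a b → lookup (integrate v₀ D) a ℤ.- lookup (integrate v₀ D) b ≡ potential D a ℤ.- potential D b
  integrate-difference v₀ D a b = ≡.trans (cong₂ ℤ._-_ (VP.lookup∘tabulate _ a) (VP.lookup∘tabulate _ b))
                                          ([i-k]-[j-k]≡i-j (potential D a) (potential D b) (potential D v₀))

  potential-difference : ∀ D {v} → v ≢ x → potential D v ℤ.- potential D (parent v) ≡ lookup D v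
  potential-difference D {v} v≢x = ≡.trans (cong (ℤ._- potential D (parent v)) (potential-parent D v≢x))
                                           (i+j-i≡j (potential D (parent v)) (lookup D v))

  integrate-increments : ∀ {v₀} f → lookup f v₀ ≡ + 0 → integrate v₀ (increments f) ≡ f
  integrate-increments {v₀} f fv₀≡0 = lookup-ext λ v → begin
      lookup (integrate v₀ (increments f)) v
    ≡⟨ VP.lookup∘tabulate _ v ⟩
      potential (increments f) v ℤ.- potential (increments f) v₀
    ≡⟨ cong₂ ℤ._-_ (potential-increments f v) (potential-increments f v₀) ⟩
      (lookup f v ℤ.- lookup f x) ℤ.- (lookup f v₀ ℤ.- lookup f x)
    ≡⟨ [i-k]-[j-k]≡i-j (lookup f v) (lookup f v₀) (lookup f x) ⟩
      lookup f v ℤ.- lookup f v₀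
    ≡⟨ cong (λ z → lookup f v ℤ.- z) fv₀≡0 ⟩
      lookup f v ℤ.- + 0
    ≡⟨ ℤP.+-identityʳ _ ⟩
      lookup f v
    ∎
    where open ≡-Reasoning

  increments-integrate : ∀ v₀ D → lookup D x ≡ + 0 → increments (integrate v₀ D) ≡ D
  increments-integrate v₀ D Dx≡0 = lookup-ext λ v → ≡.trans (VP.lookup∘tabulate _ v) (at v (v FP.≟ x))
    where
    at : ∀ v → Dec (v ≡ x) → increment (integrate v₀ D) v ≡ lookup D v
    at v (yes refl) = ≡.trans (increment-root _) (≡.sym Dx≡0)
    at v (no v≢x)   = ≡.trans (increment-nonroot _ v≢x)
                      (≡.trans (integrate-difference v₀ D v (parent v)) (potential-difference D v≢x))

-- Unicyclic graphs

module UnicyclicTree {n : ℕ} (G : SimpleGraph n) {x : Fin n} {xs : List (Fin n)}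
  (T : RootedSpanningTree G x) (chain : Linked (IsParentOf (RootedSpanningTree.parent T)) (x ∷ xs)) (x∉xs : x ∉ xs)
  (onlyCycle : ∀ C → IsCycle G C → ∀ u v → CycleEdge C u v ⇔ CycleEdge (x ∷ xs) u v) where

  open RootedSpanningTree T
  open TreeCoordinates T

  ParentEdge TreeEdge ClosingEdge : Fin n → Fin n → Set
  ParentEdge a b  = a ≢ x × parent a ≡ b
  TreeEdge a b    = ParentEdge a b ⊎ ParentEdge b a
  ClosingEdge u v = (u ≡ lastOf x xs × v ≡ x) ⊎ (u ≡ x × v ≡ lastOf x xs)

  TreeEdge-sym : ∀ {a b} → TreeEdge a b → TreeEdge b a
  TreeEdge-sym (inj₁ e) = inj₂ e
  TreeEdge-sym (inj₂ e) = inj₁ e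

  TreeEdge⇒Adj : ∀ {a b} → TreeEdge a b → Adj G a b
  TreeEdge⇒Adj (inj₁ (a≢x , refl)) = proj₁ (toParent _ a≢x)
  TreeEdge⇒Adj (inj₂ (b≢x , refl)) = sym G (proj₁ (toParent _ b≢x))

  pathToRoot : ∀ v → Σ (List (Fin n)) λ r → Linked TreeEdge (v ∷ r) × lastOf v r ≡ x
  pathToRoot = treeInduction _ ([] , [-] , refl)
    λ v≢x (r , p , last) → _ ∷ r , inj₁ (v≢x , refl) ∷ p , last

  pathFromRoot : ∀ u → Σ (List (Fin n)) λ r → Linked TreeEdge (x ∷ r) × lastOf x r ≡ u
  pathFromRoot = treeInduction _ ([] , [-] , refl)
    λ {u} u≢x (r , p , last) →
      r ++ u ∷ [] ,
      Linked-++ r p (≡.subst (λ z → TreeEdge z u) (≡.sym last) (inj₂ (u≢x , refl)) ∷ [-]) ,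
      lastOf-++ x r (u ∷ [])

  treePath : ∀ v u → Σ (List (Fin n)) λ r → Linked TreeEdge (v ∷ r) × lastOf v r ≡ u
  treePath v u =
    let r₁ , p₁ , last₁ = pathToRoot v
        r₂ , p₂ , last₂ = pathFromRoot u
    in r₁ ++ r₂ ,
       Linked-++ r₁ p₁ (≡.subst (λ z → Linked TreeEdge (z ∷ r₂)) (≡.sym last₁) p₂) ,
       ≡.trans (lastOf-++ v r₁ r₂) (≡.trans (cong (λ z → lastOf z r₂) last₁) last₂)

  consecutive⇒TreeEdge : ∀ {a ys u v} → Linked (IsParentOf parent) (a ∷ ys) → All (x ≢_) ys →
                         ConsecPair (a ∷ ys) u v → TreeEdge u v
  consecutive⇒TreeEdge (pb≡a ∷ _) (x≢b ∷ _) (inj₁ (inj₁ (refl , refl))) = inj₂ (≡.≢-sym x≢b , pb≡a)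
  consecutive⇒TreeEdge (pb≡a ∷ _) (x≢b ∷ _) (inj₁ (inj₂ (refl , refl))) = inj₁ (≡.≢-sym x≢b , pb≡a)
  consecutive⇒TreeEdge (_ ∷ p)    (_ ∷ ≢x)  (inj₂ c)                      = consecutive⇒TreeEdge p ≢x c

  cycleEdge⇒ : ∀ {u v} → CycleEdge (x ∷ xs) u v → TreeEdge u v ⊎ ClosingEdge u v
  cycleEdge⇒ (inj₁ c) = inj₁ (consecutive⇒TreeEdge chain (¬Any⇒All¬ xs x∉xs) c)
  cycleEdge⇒ (inj₂ c) = inj₂ c

  -- The tree path from v to u, made simple, closes up with uv to a cycle unless it is the single
  -- edge vu; by uniqueness that cycle has the same edges as x ∷ xs, and uv is its closing edge.
  edgeKind : ∀ {u v} → Adj G u v → TreeEdge u v ⊎ ClosingEdge u v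
  edgeKind {u} {v} uv =
    let r , p , last = treePath v u
        r′ , simple , p′ , last′ = shortcut v r p
    in viaSimplePath r′ simple p′ (≡.trans last′ last)
    where
    viaSimplePath : ∀ r → Unique (v ∷ r) → Linked TreeEdge (v ∷ r) → lastOf v r ≡ u → TreeEdge u v ⊎ ClosingEdge u v
    viaSimplePath []                _        _          refl = ⊥-elim (irrefl G uv)
    viaSimplePath (w ∷ [])          _        (vw ∷ [-]) refl = inj₁ (TreeEdge-sym vw)
    viaSimplePath r@(_ ∷ _ ∷ _)     simple   p          refl =
      cycleEdge⇒ (Equivalence.to (onlyCycle (v ∷ r) isCycle u v) (inj₂ (inj₁ (refl , refl))))
      where
      isCycle : IsCycle G (v ∷ r)
      isCycle = simple , s≤s (s≤s (s≤s z≤n)) , Linked⇒Path (Linked.map TreeEdge⇒Adj p) , uv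

module LipschitzCount {n : ℕ} (G : SimpleGraph n) {x : Fin n} {xs : List (Fin n)}
  (T : RootedSpanningTree G x) (chain : Linked (IsParentOf (RootedSpanningTree.parent T)) (x ∷ xs)) (x∉xs : x ∉ xs)
  (onlyCycle : ∀ C → IsCycle G C → ∀ u v → CycleEdge C u v ⇔ CycleEdge (x ∷ xs) u v)
  (distinct : Unique xs) (closing : Adj G (lastOf x xs) x) where

  open RootedSpanningTree T
  open TreeCoordinates T
  open UnicyclicTree G T chain x∉xs onlyCycle
  open CycleRoles x x∉xs distinct

  closingDifference : ∀ D → potential D (lastOf x xs) ℤ.- potential D x ≡ sumAt D xs
  closingDifference D = ≡.trans (cong (ℤ._- potential D x) (potential-chain D chain (¬Any⇒All¬ xs x∉xs)))
                                (i+j-i≡j (potential D x) (sumAt D xs))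

  sumAt-increments : ∀ f → sumAt (increments f) xs ≡ lookup f (lastOf x xs) ℤ.- lookup f x
  sumAt-increments f = begin
      sumAt (increments f) xs
    ≡⟨ closingDifference (increments f) ⟨
      potential (increments f) (lastOf x xs) ℤ.- potential (increments f) x
    ≡⟨ cong₂ ℤ._-_ (potential-increments f _) (potential-increments f x) ⟩
      (lookup f (lastOf x xs) ℤ.- lookup f x) ℤ.- (lookup f x ℤ.- lookup f x)
    ≡⟨ [i-k]-[j-k]≡i-j (lookup f (lastOf x xs)) (lookup f x) (lookup f x) ⟩
      lookup f (lastOf x xs) ℤ.- lookup f x
    ∎
    where open ≡-Reasoning

  module _ (v₀ : Fin n) where

    integrate-lipschitz : ∀ {D} → D ∈ withCentralSum ρ → IsLipschitz1 G v₀ (integrate v₀ D)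
    integrate-lipschitz {D} D∈ = integrate-base v₀ D , lipschitz
      where
      F = integrate v₀ D
      D∈box = proj₁ (∈-withCentralSum⁻ ρ D∈)
      central = proj₂ (∈-withCentralSum⁻ ρ D∈)
      parentBound : ∀ {u} → u ≢ x → ∣ lookup F u ℤ.- lookup F (parent u) ∣ ≤ 1
      parentBound {u} u≢x =
        ≡.subst (_≤ 1) (cong ∣_∣ (≡.sym (≡.trans (integrate-difference v₀ D u (parent u)) (potential-difference D u≢x))))
                (∈unit⇒∣∣≤1 (≡.subst (lookup D u ∈_) (values∘ρ u≢x) (∈-box⁻ _ D∈box u)))
      closingBound : ∣ lookup F (lastOf x xs) ℤ.- lookup F x ∣ ≤ 1
      closingBound =
        ≡.subst (_≤ 1) (cong ∣_∣ (≡.trans (cycleSum D) (≡.sym (≡.trans (integrate-difference v₀ D _ x) (closingDifference D)))))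
                central
      flip : ∀ {a b} → ∣ lookup F a ℤ.- lookup F b ∣ ≤ 1 → ∣ lookup F b ℤ.- lookup F a ∣ ≤ 1
      flip {a} = ≡.subst (_≤ 1) (ℤP.∣i-j∣≡∣j-i∣ (lookup F a) _)
      lipschitz : ∀ u v → Adj G u v → ∣ lookup F u ℤ.- lookup F v ∣ ≤ 1
      lipschitz u v uv with edgeKind uv
      ... | inj₁ (inj₁ (u≢x , refl))  = parentBound u≢x
      ... | inj₁ (inj₂ (v≢x , refl))  = flip (parentBound v≢x)
      ... | inj₂ (inj₁ (refl , refl)) = closingBound
      ... | inj₂ (inj₂ (refl , refl)) = flip closingBound

    increments∈withCentralSum : ∀ {f} → IsLipschitz1 G v₀ f → increments f ∈ withCentralSum ρ
    increments∈withCentralSum {f} (_ , lipschitz) = ∈-filter⁺ (centralSum? ρ) (∈-box⁺ (values ∘ ρ) (increments f) inBox) central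
      where
      central : ∣ sumOver (isSummed ∘ ρ) (increments f) ∣ ≤ 1
      central = ≡.subst (λ z → ∣ z ∣ ≤ 1) (≡.sym (≡.trans (cycleSum (increments f)) (sumAt-increments f)))
                        (lipschitz _ x closing)
      at : ∀ i → Dec (i ≡ x) → increment f i ∈ values (ρ i)
      at i (yes refl) = ≡.subst₂ _∈_ (≡.sym (increment-root f)) (cong values (≡.sym ρ-root)) (here refl)
      at i (no i≢x)   = ≡.subst₂ _∈_ (≡.sym (increment-nonroot f i≢x)) (≡.sym (values∘ρ i≢x))
                                   (∣∣≤1⇒∈unit _ (lipschitz i (parent i) (proj₁ (toParent i i≢x))))
      inBox : ∀ i → lookup (increments f) i ∈ values (ρ i)
      inBox i = ≡.subst (_∈ values (ρ i)) (≡.sym (VP.lookup∘tabulate _ i)) (at i (i FP.≟ x))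

    root≡0 : ∀ {D} → D ∈ withCentralSum ρ → lookup D x ≡ + 0
    root≡0 {D} D∈ with ≡.subst (λ r → lookup D x ∈ values r) ρ-root
                              (∈-box⁻ (values ∘ ρ) (proj₁ (∈-withCentralSum⁻ ρ D∈)) x)
    ... | here Dx≡0 = Dx≡0

    lipschitzMaps : List (Vec ℤ n)
    lipschitzMaps = map (integrate v₀) (withCentralSum ρ)

    countLipschitz : NumLipschitz1≡ G v₀ (trinomial (suc (length xs)) (+ 0) * 3 ^ (n ∸ suc (length xs)))
    countLipschitz = lipschitzMaps , unique , size , λ f → mk⇔ (to f) from
      where
      injective : ∀ {D E} → lookup D x ≡ + 0 → lookup E x ≡ + 0 → integrate v₀ D ≡ integrate v₀ E → D ≡ E
      injective {D} {E} Dx≡0 Ex≡0 eq =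
        ≡.trans (≡.sym (increments-integrate v₀ D Dx≡0)) (≡.trans (cong increments eq) (increments-integrate v₀ E Ex≡0))
      unique : Unique lipschitzMaps
      unique = Unique-map⁺-on (integrate v₀) injective (All.tabulate root≡0)
                 (Unique.filter⁺ (centralSum? ρ) (box-unique (values ∘ ρ) (values-unique ∘ ρ)))
      size : length lipschitzMaps ≡ trinomial (suc (length xs)) (+ 0) * 3 ^ (n ∸ suc (length xs))
      size = ≡.trans (LP.length-map (integrate v₀) (withCentralSum ρ))
               (≡.trans (length-withCentralSum roles)
                        (cong₂ (λ s f → trinomial (suc s) (+ 0) * 3 ^ f) count-summed count-free))
      to : ∀ f → f ∈ lipschitzMaps → IsLipschitz1 G v₀ f
      to f f∈ with ∈-map⁻ (integrate v₀) f∈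
      ... | D , D∈ , refl = integrate-lipschitz D∈
      from : ∀ {f} → IsLipschitz1 G v₀ f → f ∈ lipschitzMaps
      from {f} lip = ≡.subst (_∈ lipschitzMaps) (integrate-increments f (proj₁ lip))
                             (∈-map⁺ (integrate v₀) (increments∈withCentralSum lip))

lemma6 : (n c : ℕ) (G : SimpleGraph n) (v₀ : Fin n) →
         Connected G → UnicyclicWithCycleLength G c → 3 ≤ c → c ≤ n →
         NumLipschitz1≡ G v₀ (trinomial c (+ 0) * 3 ^ (n ∸ c))
lemma6 n c G v₀ connected ([] , () , _)
lemma6 n _ G v₀ connected (x ∷ xs , (distinct@(_ ∷ distinct-xs) , _ , path , closing) , refl , onlyCycle) _ _ =
  let T , chain = SpanningTree.spanningTreeThrough G x connected distinct (Path⇒Linked (x ∷ xs) path)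
  in LipschitzCount.countLipschitz G T chain (Unique.Unique[x∷xs]⇒x∉xs distinct) onlyCycle distinct-xs closing v₀
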